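{- Let $M$ be a simple matroid. Then $M$ is modular if and only if $M$ has an adjoint $adM$ such that $\mathcal{L}(adM)\cong\mathcal{L}(M)^{op}$.
   Context: All matroids are finite and nonempty. $\mathcal{L}(M)$ is the lattice of flats of $M$ ordered by inclusion; $\mathcal{L}(M)^{op}$ is the same set with reversed order. $M$ is modular if $r(X)+r(Y)=r(X\wedge Y)+r(X\vee Y)$ for all flats $X,Y$. A matroid $N$ is an adjoint of $M$ if $r(N)=r(M)$ and there is an injective order-reversing map $\phi:\mathcal{L}(M)\to\mathcal{L}(N)$ sending the coatoms of $\mathcal{L}(M)$ bijectively onto the atoms of $\mathcal{L}(N)$. -}

module Defs where

open import Data.Nat using (ℕ; suc; _≤_; _+_; _≟_)
open import Data.Fin using (Fin)
open import Data.Fin.Subset using (Subset; _∈_; _⊆_; _∪_; _∩_; ⁅_⁆; ∣_∣; ⊤; inside; outside)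
open import Data.Vec using (tabulate)
open import Data.Bool using (if_then_else_)
open import Data.Product using (Σ; _×_; proj₁)
open import Data.Sum using (_⊎_)
open import Relation.Nullary using (¬_; ⌊_⌋)
open import Relation.Binary.PropositionalEquality using (_≡_; _≢_)

record Matroid (n : ℕ) : Set where
  field
    r       : Subset n → ℕ
    r-card  : ∀ X → r X ≤ ∣ X ∣
    r-mono  : ∀ {X Y} → X ⊆ Y → r X ≤ r Y
    r-submod : ∀ X Y → r (X ∪ Y) + r (X ∩ Y) ≤ r X + r Y

open Matroid public

module _ {n : ℕ} (M : Matroid n) where

  rk : ℕ
  rk = r M ⊤

  cl : Subset n → Subset n
  cl X = tabulate (λ e → if ⌊ r M (X ∪ ⁅ e ⁆) ≟ r M X ⌋ then inside else outside)

  IsFlat : Subset n → Set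
  IsFlat X = ∀ e → r M (X ∪ ⁅ e ⁆) ≡ r M X → e ∈ X

  Flat : Set
  Flat = Σ (Subset n) IsFlat

  _≤F_ : Flat → Flat → Set
  F ≤F G = proj₁ F ⊆ proj₁ G

  _≈F_ : Flat → Flat → Set
  F ≈F G = proj₁ F ≡ proj₁ G

  IsTop : Flat → Set
  IsTop F = ∀ G → G ≤F F

  IsBottom : Flat → Set
  IsBottom F = ∀ G → F ≤F G

  IsCoatom : Flat → Set
  IsCoatom H = ¬ IsTop H × (∀ G → H ≤F G → G ≤F H ⊎ IsTop G)

  IsAtom : Flat → Set
  IsAtom A = ¬ IsBottom A × (∀ G → G ≤F A → A ≤F G ⊎ IsBottom G)

  Simple : Set
  Simple = (∀ e → r M ⁅ e ⁆ ≡ 1) × (∀ e f → e ≢ f → r M (⁅ e ⁆ ∪ ⁅ f ⁆) ≡ 2)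

  Modular : Set
  Modular = ∀ (X Y : Subset n) → IsFlat X → IsFlat Y →
            r M X + r M Y ≡ r M (X ∩ Y) + r M (cl (X ∪ Y))

record Adjoint {n : ℕ} (M : Matroid n) {m : ℕ} (N : Matroid m) : Set where
  field
    φ         : Flat M → Flat N
    rank-eq   : rk N ≡ rk M
    injective : ∀ X Y → _≈F_ N (φ X) (φ Y) → _≈F_ M X Y
    antitone  : ∀ X Y → _≤F_ M X Y → _≤F_ N (φ Y) (φ X)
    coatom→atom : ∀ H → IsCoatom M H → IsAtom N (φ H)
    atom-onto   : ∀ A → IsAtom N A → Σ (Flat M) (λ H → IsCoatom M H × _≈F_ N (φ H) A)

record FlatsAntiIso {m : ℕ} (N : Matroid m) {n : ℕ} (M : Matroid n) : Set where
  field
    to      : Flat N → Flat M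
    from    : Flat M → Flat N
    from-to : ∀ X → _≈F_ N (from (to X)) X
    to-from : ∀ Y → _≈F_ M (to (from Y)) Y
    to-rev  : ∀ X Y → _≤F_ N X Y → _≤F_ M (to Y) (to X)
    to-rev⁻ : ∀ X Y → _≤F_ M (to Y) (to X) → _≤F_ N X Y

{-# OPTIONS --safe #-}
-- Both lattices of flats are graded by rank, and an anti-isomorphism L(N) ≅ L(M)^op maps covers
-- to covers; hence r_N(φ F) + r_M(F) is constant, and submodularity of r_N, read through this
-- identity, is the missing inequality r(X) + r(Y) ≤ r(X ∧ Y) + r(X ∨ Y) in M.
-- Conversely, for modular M let N have an element for each hyperplane of M, a set T of them having
-- rank the corank of their intersection; modularity of M is exactly what makes this submodular.
-- Every flat of M is the intersection of the hyperplanes containing it, so T ↦ ⋂ T is an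
-- anti-isomorphism L(N) ≅ L(M)^op, and such an anti-isomorphism of equal rank is an adjoint.
module Submission where

open import Defs
open import Data.Nat using (ℕ; zero; suc; _+_; _∸_; _≤_; _≟_; z<s)
open import Data.Nat.Properties
open import Data.Fin using (Fin; zero; suc)
open import Data.Fin.Properties using (¬∀⟶∃¬; all?)
open import Data.Fin.Subset
open import Data.Fin.Subset.Properties
  using (_∈?_; _⊆?_; ⊆-refl; ⊆-reflexive; ⊆-antisym; ⊆⊤; ∈⊤; ∣⊥∣≡0; x∈⁅x⁆; x∈⁅y⁆⇒x≡y; ∣⁅x⁆∣≡1;
         p⊆p∪q; q⊆p∪q; x∈p∪q⁻; p∩q⊆p; p∩q⊆q; x∈p∩q⁺; x∈p∩q⁻)
open import Data.Bool using (true; false; if_then_else_)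
open import Data.Vec using ([]; _∷_; tabulate; here; there)
open import Data.Vec.Properties using (lookup∘tabulate; []=⇒lookup; lookup⇒[]=)
open import Data.List using (List; []; _∷_; foldr; filter; allFin; length; lookup; map; _++_)
open import Data.List.Relation.Unary.All using (All; []; _∷_)
open import Data.List.Relation.Unary.All.Properties using (all-filter)
import Data.List.Relation.Unary.Any as Any
open import Data.List.Relation.Unary.Any.Properties using (lookup-index)
import Data.List.Membership.Propositional as List
open import Data.List.Membership.Propositional.Properties using (∈-filter⁺; ∈-allFin; ∈-map⁺; ∈-++⁺ˡ; ∈-++⁺ʳ)
open import Data.Product using (Σ; ∃; _×_; _,_; proj₁; proj₂)
open import Data.Sum using (_⊎_; inj₁; inj₂; [_,_])
open import Function using (_∘_)
open import Relation.Nullary using (¬_; Dec; yes; no; ⌊_⌋; contradiction)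
open import Relation.Nullary.Decidable using (_×-dec_; _→-dec_)
open import Relation.Binary.PropositionalEquality using (_≡_; refl; sym; trans; cong; cong₂; subst; subst₂; module ≡-Reasoning)
open import Algebra.Properties.CommutativeSemigroup +-commutativeSemigroup using (interchange)

module _ {k : ℕ} where

  ⊆-∪ˡ : {X Y : Subset k} → X ⊆ X ∪ Y
  ⊆-∪ˡ {X} {Y} = p⊆p∪q Y

  ⊆-∪ʳ : {X Y : Subset k} → Y ⊆ X ∪ Y
  ⊆-∪ʳ {X} {Y} = q⊆p∪q X Y

  ∩-⊆ˡ : {X Y : Subset k} → X ∩ Y ⊆ X
  ∩-⊆ˡ {X} {Y} = p∩q⊆p X Y

  ∩-⊆ʳ : {X Y : Subset k} → X ∩ Y ⊆ Y
  ∩-⊆ʳ {X} {Y} = p∩q⊆q X Y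

  ∪-lub : {X Y Z : Subset k} → X ⊆ Z → Y ⊆ Z → X ∪ Y ⊆ Z
  ∪-lub {X} {Y} X⊆Z Y⊆Z p = [ X⊆Z , Y⊆Z ] (x∈p∪q⁻ X Y p)

  ∩-glb : {X Y Z : Subset k} → Z ⊆ X → Z ⊆ Y → Z ⊆ X ∩ Y
  ∩-glb Z⊆X Z⊆Y p = x∈p∩q⁺ (Z⊆X p , Z⊆Y p)

  ∪-mono : {X Y X′ Y′ : Subset k} → X ⊆ X′ → Y ⊆ Y′ → X ∪ Y ⊆ X′ ∪ Y′
  ∪-mono X⊆X′ Y⊆Y′ = ∪-lub (⊆-∪ˡ ∘ X⊆X′) (⊆-∪ʳ ∘ Y⊆Y′)

  ⁅⁆-⊆ : {X : Subset k} {e : Fin k} → e ∈ X → ⁅ e ⁆ ⊆ X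
  ⁅⁆-⊆ {X} {e} e∈X p = subst (_∈ X) (sym (x∈⁅y⁆⇒x≡y e p)) e∈X

  ⊈⇒∃∉ : {X Y : Subset k} → ¬ (X ⊆ Y) → ∃ λ e → e ∈ X × e ∉ Y
  ⊈⇒∃∉ {X} {Y} X⊈Y with ¬∀⟶∃¬ k (λ e → e ∈ X → e ∈ Y) (λ e → e ∈? X →-dec e ∈? Y) (λ h → X⊈Y (h _))
  ... | e , ¬[e∈X⇒e∈Y] with e ∈? X
  ...   | yes e∈X = e , e∈X , λ e∈Y → ¬[e∈X⇒e∈Y] (λ _ → e∈Y)
  ...   | no e∉X = contradiction (λ e∈X → contradiction e∈X e∉X) ¬[e∈X⇒e∈Y]

toSubset : ∀ {j} {P : Fin j → Set} → (∀ i → Dec (P i)) → Subset j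
toSubset P? = tabulate (λ i → if ⌊ P? i ⌋ then inside else outside)

module _ {j : ℕ} {P : Fin j → Set} (P? : ∀ i → Dec (P i)) where

  ∈-toSubset⁺ : ∀ {i} → P i → i ∈ toSubset P?
  ∈-toSubset⁺ {i} Pi with P? i | lookup⇒[]= i (toSubset P?) (lookup∘tabulate (λ i → if ⌊ P? i ⌋ then inside else outside) i)
  ... | yes _ | i∈S = i∈S
  ... | no ¬Pi | _ = contradiction Pi ¬Pi

  ∈-toSubset⁻ : ∀ {i} → i ∈ toSubset P? → P i
  ∈-toSubset⁻ {i} i∈S with P? i | trans (sym (lookup∘tabulate (λ i → if ⌊ P? i ⌋ then inside else outside) i)) ([]=⇒lookup i∈S)
  ... | yes Pi | _ = Pi
  ... | no _ | ()

infix 4 _⊑_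
_⊑_ : ∀ {n} {P : Subset n → Set} → Σ (Subset n) P → Σ (Subset n) P → Set
F ⊑ G = proj₁ F ⊆ proj₁ G

⋂[_]_ : ∀ {j k} → Subset j → (Fin j → Subset k) → Subset k
⋂[ [] ] f = ⊤
⋂[ true ∷ T ] f = f zero ∩ ⋂[ T ] (f ∘ suc)
⋂[ false ∷ T ] f = ⋂[ T ] (f ∘ suc)

module _ {k : ℕ} where

  ∈⋂⁺ : ∀ {j} (T : Subset j) f {e : Fin k} → (∀ {i} → i ∈ T → e ∈ f i) → e ∈ ⋂[ T ] f
  ∈⋂⁺ [] _ _ = ∈⊤
  ∈⋂⁺ (true ∷ T) f h = x∈p∩q⁺ (h here , ∈⋂⁺ T (f ∘ suc) (h ∘ there))
  ∈⋂⁺ (false ∷ T) f h = ∈⋂⁺ T (f ∘ suc) (h ∘ there)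

  ∈⋂⁻ : ∀ {j} (T : Subset j) f {e : Fin k} → e ∈ ⋂[ T ] f → ∀ {i} → i ∈ T → e ∈ f i
  ∈⋂⁻ (true ∷ T) f e∈⋂ here = proj₁ (x∈p∩q⁻ _ _ e∈⋂)
  ∈⋂⁻ (true ∷ T) f e∈⋂ (there i∈T) = ∈⋂⁻ T (f ∘ suc) (proj₂ (x∈p∩q⁻ _ _ e∈⋂)) i∈T
  ∈⋂⁻ (false ∷ T) f e∈⋂ (there i∈T) = ∈⋂⁻ T (f ∘ suc) e∈⋂ i∈T

  ⋂-antitone : ∀ {j} {T T′ : Subset j} (f : Fin j → Subset k) → T ⊆ T′ → ⋂[ T′ ] f ⊆ ⋂[ T ] f
  ⋂-antitone {T = T} {T′} f T⊆T′ p = ∈⋂⁺ T f (λ i∈T → ∈⋂⁻ T′ f p (T⊆T′ i∈T))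

subsets : (j : ℕ) → List (Subset j)
subsets zero = [] ∷ []
subsets (suc j) = map (inside ∷_) (subsets j) ++ map (outside ∷_) (subsets j)

∈-subsets : ∀ {j} (X : Subset j) → X List.∈ subsets j
∈-subsets [] = Any.here refl
∈-subsets (true ∷ X) = ∈-++⁺ˡ (∈-map⁺ (inside ∷_) (∈-subsets X))
∈-subsets (false ∷ X) = ∈-++⁺ʳ (map (inside ∷_) (subsets _)) (∈-map⁺ (outside ∷_) (∈-subsets X))

∸-+-≡ : ∀ K {a b c d} → a ≤ K → b ≤ K → c ≤ K → d ≤ K → a + b ≡ c + d → (K ∸ c) + (K ∸ d) ≡ (K ∸ a) + (K ∸ b)
∸-+-≡ K {a} {b} {c} {d} a≤K b≤K c≤K d≤K eq = +-cancelʳ-≡ (a + b) _ _ (begin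
  (K ∸ c) + (K ∸ d) + (a + b) ≡⟨ cong ((K ∸ c) + (K ∸ d) +_) eq ⟩
  (K ∸ c) + (K ∸ d) + (c + d) ≡⟨ complement-sum c≤K d≤K ⟩
  K + K                        ≡⟨ complement-sum a≤K b≤K ⟨
  (K ∸ a) + (K ∸ b) + (a + b) ∎)
  where
  open ≡-Reasoning
  complement-sum : ∀ {x y} → x ≤ K → y ≤ K → (K ∸ x) + (K ∸ y) + (x + y) ≡ K + K
  complement-sum {x} {y} x≤K y≤K =
    trans (interchange (K ∸ x) (K ∸ y) x y) (cong₂ _+_ (m∸n+n≡m x≤K) (m∸n+n≡m y≤K))

module FlatTheory {k : ℕ} (M : Matroid k) where

  r-⊥ : r M ⊥ ≡ 0
  r-⊥ = n≤0⇒n≡0 (subst (r M ⊥ ≤_) (∣⊥∣≡0 k) (r-card M ⊥))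

  r≤rk : ∀ X → r M X ≤ rk M
  r≤rk X = r-mono M ⊆⊤

  r-∪⁅⁆-≤ : ∀ X e → r M (X ∪ ⁅ e ⁆) ≤ suc (r M X)
  r-∪⁅⁆-≤ X e = begin
    r M (X ∪ ⁅ e ⁆)                          ≤⟨ m≤m+n _ _ ⟩
    r M (X ∪ ⁅ e ⁆) + r M (X ∩ ⁅ e ⁆)        ≤⟨ r-submod M X ⁅ e ⁆ ⟩
    r M X + r M ⁅ e ⁆                        ≤⟨ +-monoʳ-≤ (r M X) r⁅e⁆≤1 ⟩
    r M X + 1                                ≡⟨ +-comm (r M X) 1 ⟩
    suc (r M X)                              ∎
    where
    open ≤-Reasoning
    r⁅e⁆≤1 : r M ⁅ e ⁆ ≤ 1
    r⁅e⁆≤1 = subst (r M ⁅ e ⁆ ≤_) (∣⁅x⁆∣≡1 e) (r-card M ⁅ e ⁆)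

  -- Submodularity for Z and X ∪ Y, whose intersection contains X.
  r-∪-spanned : ∀ {X Z} Y → X ⊆ Z → r M (X ∪ Y) ≡ r M X → r M (Z ∪ Y) ≡ r M Z
  r-∪-spanned {X} {Z} Y X⊆Z XY≡X = ≤-antisym ZY≤Z (r-mono M ⊆-∪ˡ)
    where
    ZY≤Z : r M (Z ∪ Y) ≤ r M Z
    ZY≤Z = +-cancelʳ-≤ (r M X) _ _ (begin
      r M (Z ∪ Y) + r M X                  ≤⟨ +-mono-≤ (r-mono M (∪-mono ⊆-refl ⊆-∪ʳ)) (r-mono M (∩-glb X⊆Z ⊆-∪ˡ)) ⟩
      r M (Z ∪ (X ∪ Y)) + r M (Z ∩ (X ∪ Y)) ≤⟨ r-submod M Z (X ∪ Y) ⟩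
      r M Z + r M (X ∪ Y)                  ≡⟨ cong (r M Z +_) XY≡X ⟩
      r M Z + r M X                        ∎)
      where open ≤-Reasoning

  ∈cl⁺ : ∀ {X e} → r M (X ∪ ⁅ e ⁆) ≡ r M X → e ∈ cl M X
  ∈cl⁺ {X} = ∈-toSubset⁺ (λ e → r M (X ∪ ⁅ e ⁆) ≟ r M X)

  ∈cl⁻ : ∀ {X e} → e ∈ cl M X → r M (X ∪ ⁅ e ⁆) ≡ r M X
  ∈cl⁻ {X} = ∈-toSubset⁻ (λ e → r M (X ∪ ⁅ e ⁆) ≟ r M X)

  ⊆-cl : ∀ X → X ⊆ cl M X
  ⊆-cl X e∈X = ∈cl⁺ (cong (r M) (⊆-antisym (∪-lub ⊆-refl (⁅⁆-⊆ e∈X)) ⊆-∪ˡ))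

  cl-least : ∀ {X F} → IsFlat M F → X ⊆ F → cl M X ⊆ F
  cl-least {X} {F} F-flat X⊆F {e} e∈clX = F-flat e (r-∪-spanned ⁅ e ⁆ X⊆F (∈cl⁻ e∈clX))

  _∪ₗ_ : Subset k → List (Fin k) → Subset k
  X ∪ₗ ys = foldr (λ y Z → Z ∪ ⁅ y ⁆) X ys

  r-∪ₗ-spanned : ∀ X ys → All (_∈ cl M X) ys → r M (X ∪ₗ ys) ≡ r M X
  r-∪ₗ-spanned X [] [] = refl
  r-∪ₗ-spanned X (y ∷ ys) (y∈clX ∷ ys⊆clX) = begin
    r M ((X ∪ₗ ys) ∪ ⁅ y ⁆) ≡⟨ r-∪-spanned ⁅ y ⁆ (⊆-∪ₗ ys) (∈cl⁻ y∈clX) ⟩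
    r M (X ∪ₗ ys)           ≡⟨ r-∪ₗ-spanned X ys ys⊆clX ⟩
    r M X                   ∎
    where
    open ≡-Reasoning
    ⊆-∪ₗ : ∀ zs → X ⊆ X ∪ₗ zs
    ⊆-∪ₗ [] = ⊆-refl
    ⊆-∪ₗ (z ∷ zs) = ⊆-∪ˡ ∘ ⊆-∪ₗ zs

  ∈-∪ₗ : ∀ X {ys y} → y List.∈ ys → y ∈ X ∪ₗ ys
  ∈-∪ₗ X (Any.here refl) = ⊆-∪ʳ (x∈⁅x⁆ _)
  ∈-∪ₗ X (Any.there y∈ys) = ⊆-∪ˡ (∈-∪ₗ X y∈ys)

  r-cl : ∀ X → r M (cl M X) ≡ r M X
  r-cl X = ≤-antisym
    (≤-trans (r-mono M (λ y∈clX → ∈-∪ₗ X (∈-filter⁺ (_∈? cl M X) (∈-allFin _) y∈clX)))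
             (≤-reflexive (r-∪ₗ-spanned X spanned (all-filter (_∈? cl M X) (allFin k)))))
    (r-mono M (⊆-cl X))
    where
    spanned : List (Fin k)
    spanned = filter (_∈? cl M X) (allFin k)

  cl-flat : ∀ X → IsFlat M (cl M X)
  cl-flat X e eq = ∈cl⁺ (≤-antisym
    (≤-trans (r-mono M (∪-mono (⊆-cl X) ⊆-refl)) (≤-reflexive (trans eq (r-cl X))))
    (r-mono M ⊆-∪ˡ))

  flat-rank-⊆ : ∀ {F G} → IsFlat M F → F ⊆ G → r M G ≤ r M F → G ⊆ F
  flat-rank-⊆ {F} {G} F-flat F⊆G rG≤rF {e} e∈G =
    F-flat e (≤-antisym (≤-trans (r-mono M (∪-lub F⊆G (⁅⁆-⊆ e∈G))) rG≤rF) (r-mono M ⊆-∪ˡ))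

  flat-∪⁅⁆-rank : ∀ {F e} → IsFlat M F → e ∉ F → r M (F ∪ ⁅ e ⁆) ≡ suc (r M F)
  flat-∪⁅⁆-rank {F} {e} F-flat e∉F =
    ≤-antisym (r-∪⁅⁆-≤ F e) (≤∧≢⇒< (r-mono M ⊆-∪ˡ) (λ eq → e∉F (F-flat e (sym eq))))

  cl-exchange : ∀ {F e g} → IsFlat M F → e ∉ F → e ∈ cl M (F ∪ ⁅ g ⁆) → g ∈ cl M (F ∪ ⁅ e ⁆)
  cl-exchange {F} {e} {g} F-flat e∉F e∈cl = ∈cl⁺ (≤-antisym (begin
    r M ((F ∪ ⁅ e ⁆) ∪ ⁅ g ⁆) ≤⟨ r-mono M (∪-lub (∪-mono ⊆-∪ˡ ⊆-refl) (⊆-∪ˡ ∘ ⊆-∪ʳ)) ⟩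
    r M ((F ∪ ⁅ g ⁆) ∪ ⁅ e ⁆) ≡⟨ ∈cl⁻ e∈cl ⟩
    r M (F ∪ ⁅ g ⁆)           ≤⟨ r-∪⁅⁆-≤ F g ⟩
    suc (r M F)               ≡⟨ flat-∪⁅⁆-rank F-flat e∉F ⟨
    r M (F ∪ ⁅ e ⁆)           ∎) (r-mono M ⊆-∪ˡ))
    where open ≤-Reasoning

  ∩-flat : ∀ {F G} → IsFlat M F → IsFlat M G → IsFlat M (F ∩ G)
  ∩-flat F-flat G-flat e eq =
    x∈p∩q⁺ (cl-least F-flat ∩-⊆ˡ (∈cl⁺ eq) , cl-least G-flat ∩-⊆ʳ (∈cl⁺ eq))

  ⋂-flat : ∀ {j} (T : Subset j) {f} → (∀ i → IsFlat M (f i)) → IsFlat M (⋂[ T ] f)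
  ⋂-flat [] _ _ _ = ∈⊤
  ⋂-flat (true ∷ T) f-flat = ∩-flat (f-flat zero) (⋂-flat T (f-flat ∘ suc))
  ⋂-flat (false ∷ T) f-flat = ⋂-flat T (f-flat ∘ suc)

  ⊤ᶠ : Flat M
  ⊤ᶠ = ⊤ , λ _ _ → ∈⊤

  adjoin : Flat M → Fin k → Flat M
  adjoin F e = cl M (proj₁ F ∪ ⁅ e ⁆) , cl-flat _

  ⊑-adjoin : ∀ F e → F ⊑ adjoin F e
  ⊑-adjoin F e = ⊆-cl _ ∘ ⊆-∪ˡ

  ∈-adjoin : ∀ F e → e ∈ proj₁ (adjoin F e)
  ∈-adjoin F e = ⊆-cl _ (⊆-∪ʳ (x∈⁅x⁆ e))

  adjoin-least : ∀ F G {e} → F ⊑ G → e ∈ proj₁ G → adjoin F e ⊑ G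
  adjoin-least F G F⊑G e∈G = cl-least (proj₂ G) (∪-lub F⊑G (⁅⁆-⊆ e∈G))

  r-adjoin : ∀ F {e} → e ∉ proj₁ F → r M (proj₁ (adjoin F e)) ≡ suc (r M (proj₁ F))
  r-adjoin F e∉F = trans (r-cl _) (flat-∪⁅⁆-rank (proj₂ F) e∉F)

  infix 4 _⋖_
  _⋖_ : Flat M → Flat M → Set
  F ⋖ G = F ⊑ G × ¬ (G ⊑ F) × (∀ K → F ⊑ K → K ⊑ G → K ⊑ F ⊎ G ⊑ K)

  ⋖-rank : ∀ {F G} → F ⋖ G → r M (proj₁ G) ≡ suc (r M (proj₁ F))
  ⋖-rank {F} {G} (F⊑G , G⋢F , between) with ⊈⇒∃∉ G⋢F
  ... | e , e∈G , e∉F with between (adjoin F e) (⊑-adjoin F e) (adjoin-least F G F⊑G e∈G)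
  ...   | inj₁ F+e⊑F = contradiction (F+e⊑F (∈-adjoin F e)) e∉F
  ...   | inj₂ G⊑F+e = ≤-antisym
          (≤-trans (r-mono M G⊑F+e) (≤-reflexive (r-adjoin F e∉F)))
          (≤-trans (≤-reflexive (sym (r-adjoin F e∉F))) (r-mono M (adjoin-least F G F⊑G e∈G)))

  ⋖-adjoin : ∀ F {e} → e ∉ proj₁ F → F ⋖ adjoin F e
  ⋖-adjoin F {e} e∉F = ⊑-adjoin F e , (λ F+e⊑F → e∉F (F+e⊑F (∈-adjoin F e))) , between
    where
    between : ∀ K → F ⊑ K → K ⊑ adjoin F e → K ⊑ F ⊎ adjoin F e ⊑ K
    between K F⊑K K⊑F+e with proj₁ K ⊆? proj₁ F
    ... | yes K⊑F = inj₁ K⊑F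
    ... | no K⋢F with ⊈⇒∃∉ K⋢F
    ...   | x , x∈K , x∉F = inj₂ (flat-rank-⊆ (proj₂ K) K⊑F+e (begin
            r M (proj₁ (adjoin F e)) ≡⟨ r-adjoin F e∉F ⟩
            suc (r M (proj₁ F))      ≡⟨ r-adjoin F x∉F ⟨
            r M (proj₁ (adjoin F x)) ≤⟨ r-mono M (adjoin-least F K F⊑K x∈K) ⟩
            r M (proj₁ K)            ∎))
      where open ≤-Reasoning

  IsHyperplane : Subset k → Set
  IsHyperplane X = IsFlat M X × suc (r M X) ≡ rk M

  isHyperplane? : ∀ X → Dec (IsHyperplane X)
  isHyperplane? X = all? (λ e → (r M (X ∪ ⁅ e ⁆) ≟ r M X) →-dec (e ∈? X)) ×-dec (suc (r M X) ≟ rk M)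

  -- Adjoin elements g ∉ cl(F ∪ e) until the corank is 1; by exchange e stays outside.
  hyperplane-separating : ∀ F {e} → e ∉ proj₁ F → ∃ λ X → IsHyperplane X × proj₁ F ⊆ X × e ∉ X
  hyperplane-separating F e∉F = grow (rk M ∸ suc (r M (proj₁ F))) F e∉F
    (m∸n+n≡m (≤-trans (≤-reflexive (sym (flat-∪⁅⁆-rank (proj₂ F) e∉F))) (r≤rk _)))
    where
    grow : ∀ fuel F {e} → e ∉ proj₁ F → fuel + suc (r M (proj₁ F)) ≡ rk M →
           ∃ λ X → IsHyperplane X × proj₁ F ⊆ X × e ∉ X
    grow zero (F , F-flat) e∉F corank≡1 = F , (F-flat , corank≡1) , ⊆-refl , e∉F
    grow (suc fuel) F {e} e∉F eq with ⊤ ⊆? proj₁ (adjoin F e)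
    ... | yes ⊤⊆F+e = contradiction (begin
          suc fuel + suc (r M (proj₁ F)) ≡⟨ eq ⟩
          rk M                           ≤⟨ r-mono M ⊤⊆F+e ⟩
          r M (proj₁ (adjoin F e))       ≡⟨ r-adjoin F e∉F ⟩
          suc (r M (proj₁ F))            ∎) (<⇒≱ (m<n+m _ z<s))
      where open ≤-Reasoning
    ... | no ⊤⊈F+e with ⊈⇒∃∉ ⊤⊈F+e
    ...   | g , _ , g∉F+e with grow fuel (adjoin F g) e∉F+g eq′
      where
      g∉F : g ∉ proj₁ F
      g∉F = g∉F+e ∘ ⊑-adjoin F e
      e∉F+g : e ∉ proj₁ (adjoin F g)
      e∉F+g = g∉F+e ∘ cl-exchange (proj₂ F) e∉F
      eq′ : fuel + suc (r M (proj₁ (adjoin F g))) ≡ rk M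
      eq′ = trans (cong (λ x → fuel + suc x) (r-adjoin F g∉F)) (trans (+-suc fuel _) eq)
    ...     | X , X-hyp , F+g⊆X , e∉X = X , X-hyp , F+g⊆X ∘ ⊑-adjoin F g , e∉X

  module _ (modular : Modular M) where

    modular-∩-corank : ∀ {X Z} → IsFlat M X → IsFlat M Z → rk M ≤ suc (r M X) → r M Z ≤ suc (r M (X ∩ Z))
    modular-∩-corank {X} {Z} X-flat Z-flat rk≤1+rX = +-cancelˡ-≤ (r M X) _ _ (begin
      r M X + r M Z                           ≡⟨ modular X Z X-flat Z-flat ⟩
      r M (X ∩ Z) + r M (cl M (X ∪ Z))        ≤⟨ +-monoʳ-≤ (r M (X ∩ Z)) (≤-trans (r≤rk _) rk≤1+rX) ⟩
      r M (X ∩ Z) + suc (r M X)               ≡⟨ +-suc _ _ ⟩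
      suc (r M (X ∩ Z) + r M X)               ≡⟨ cong suc (+-comm _ (r M X)) ⟩
      suc (r M X + r M (X ∩ Z))               ≡⟨ +-suc _ _ ⟨
      r M X + suc (r M (X ∩ Z))               ∎)
      where open ≤-Reasoning

    ⋂-corank-≤ : ∀ {j} (T : Subset j) {f} → (∀ i → IsFlat M (f i)) → (∀ i → rk M ≤ suc (r M (f i))) →
                 rk M ≤ r M (⋂[ T ] f) + ∣ T ∣
    ⋂-corank-≤ [] _ _ = ≤-reflexive (sym (+-identityʳ _))
    ⋂-corank-≤ (false ∷ T) f-flat f-corank = ⋂-corank-≤ T (f-flat ∘ suc) (f-corank ∘ suc)
    ⋂-corank-≤ (true ∷ T) {f} f-flat f-corank = begin
      rk M                                      ≤⟨ ⋂-corank-≤ T (f-flat ∘ suc) (f-corank ∘ suc) ⟩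
      r M Z + ∣ T ∣                             ≤⟨ +-monoˡ-≤ ∣ T ∣ (modular-∩-corank (f-flat zero) Z-flat (f-corank zero)) ⟩
      suc (r M (f zero ∩ Z)) + ∣ T ∣            ≡⟨ +-suc _ _ ⟨
      r M (f zero ∩ Z) + suc ∣ T ∣              ∎
      where
      open ≤-Reasoning
      Z : Subset k
      Z = ⋂[ T ] (f ∘ suc)
      Z-flat : IsFlat M Z
      Z-flat = ⋂-flat T (f-flat ∘ suc)

+-constant-≤ : ∀ {A : Set} (f g : A → ℕ) {c} → (∀ x → f x + g x ≡ c) →
               ∀ x₁ x₂ x₃ x₄ → f x₁ + f x₂ ≤ f x₃ + f x₄ → g x₃ + g x₄ ≤ g x₁ + g x₂
+-constant-≤ f g sum≡c x₁ x₂ x₃ x₄ f₁₂≤f₃₄ = +-cancelˡ-≤ (f x₃ + f x₄) _ _ (begin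
  (f x₃ + f x₄) + (g x₃ + g x₄) ≡⟨ interchange (f x₃) (f x₄) (g x₃) (g x₄) ⟩
  (f x₃ + g x₃) + (f x₄ + g x₄) ≡⟨ cong₂ _+_ (trans (sum≡c x₃) (sym (sum≡c x₁))) (trans (sum≡c x₄) (sym (sum≡c x₂))) ⟩
  (f x₁ + g x₁) + (f x₂ + g x₂) ≡⟨ interchange (f x₁) (g x₁) (f x₂) (g x₂) ⟩
  (f x₁ + f x₂) + (g x₁ + g x₂) ≤⟨ +-monoˡ-≤ (g x₁ + g x₂) f₁₂≤f₃₄ ⟩
  (f x₃ + f x₄) + (g x₁ + g x₂) ∎)
  where open ≤-Reasoning

module AntiIso {n m : ℕ} {M : Matroid n} {N : Matroid m} (I : FlatsAntiIso N M) where
  open FlatsAntiIso I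
  private
    module M = FlatTheory M
    module N = FlatTheory N

  from-antitone : ∀ {X Y} → X ⊑ Y → from Y ⊑ from X
  from-antitone {X} {Y} X⊑Y = to-rev⁻ (from Y) (from X) (subst₂ _⊆_ (sym (to-from X)) (sym (to-from Y)) X⊑Y)

  from-reflects : ∀ {X Y} → from Y ⊑ from X → X ⊑ Y
  from-reflects {X} {Y} h = subst₂ _⊆_ (to-from X) (to-from Y) (to-rev (from Y) (from X) h)

  ⊑from⇒⊑to : ∀ {X K} → K ⊑ from X → X ⊑ to K
  ⊑from⇒⊑to {X} {K} h = subst (_⊆ proj₁ (to K)) (to-from X) (to-rev K (from X) h)

  ⊑to⇒⊑from : ∀ {X K} → X ⊑ to K → K ⊑ from X
  ⊑to⇒⊑from {X} {K} h = subst (_⊆ proj₁ (from X)) (from-to K) (from-antitone h)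

  from⊑⇒to⊑ : ∀ {X K} → from X ⊑ K → to K ⊑ X
  from⊑⇒to⊑ {X} {K} h = subst (proj₁ (to K) ⊆_) (to-from X) (to-rev (from X) K h)

  to⊑⇒from⊑ : ∀ {X K} → to K ⊑ X → from X ⊑ K
  to⊑⇒from⊑ {X} {K} h = subst (proj₁ (from X) ⊆_) (from-to K) (from-antitone h)

  from-⋖ : ∀ {F G} → F M.⋖ G → from G N.⋖ from F
  from-⋖ {F} {G} (F⊑G , G⋢F , between) = from-antitone F⊑G , G⋢F ∘ from-reflects , between′
    where
    between′ : ∀ K → from G ⊑ K → K ⊑ from F → K ⊑ from G ⊎ from F ⊑ K
    between′ K G⊑K K⊑F with between (to K) (⊑from⇒⊑to K⊑F) (from⊑⇒to⊑ G⊑K)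
    ... | inj₁ K⊑F′ = inj₂ (to⊑⇒from⊑ K⊑F′)
    ... | inj₂ G⊑K′ = inj₁ (⊑to⇒⊑from G⊑K′)

  rank-sum : ∀ F → r N (proj₁ (from F)) + r M (proj₁ F) ≡ r N (proj₁ (from M.⊤ᶠ)) + rk M
  rank-sum F = go (rk M ∸ r M (proj₁ F)) F (m∸n+n≡m (M.r≤rk _))
    where
    go : ∀ fuel F → fuel + r M (proj₁ F) ≡ rk M → r N (proj₁ (from F)) + r M (proj₁ F) ≡ r N (proj₁ (from M.⊤ᶠ)) + rk M
    go zero F eq = cong₂ _+_ (cong (r N) (⊆-antisym (from-antitone {M.⊤ᶠ} {F} ⊤⊆F) (from-antitone {F} {M.⊤ᶠ} ⊆⊤))) eq
      where
      ⊤⊆F : ⊤ ⊆ proj₁ F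
      ⊤⊆F = M.flat-rank-⊆ (proj₂ F) ⊆⊤ (≤-reflexive (sym eq))
    go (suc fuel) F eq with ⊤ ⊆? proj₁ F
    ... | yes ⊤⊆F = contradiction (≤-trans (≤-reflexive eq) (r-mono M ⊤⊆F)) (<⇒≱ (m<n+m _ z<s))
    ... | no ⊤⊈F with ⊈⇒∃∉ ⊤⊈F
    ...   | e , _ , e∉F = begin
          r N (proj₁ (from F)) + r M (proj₁ F)          ≡⟨ cong (_+ r M (proj₁ F)) (N.⋖-rank {from G} {from F} fromG⋖fromF) ⟩
          suc (r N (proj₁ (from G))) + r M (proj₁ F)    ≡⟨ +-suc (r N (proj₁ (from G))) _ ⟨
          r N (proj₁ (from G)) + suc (r M (proj₁ F))    ≡⟨ cong (r N (proj₁ (from G)) +_) (M.r-adjoin F e∉F) ⟨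
          r N (proj₁ (from G)) + r M (proj₁ G)          ≡⟨ go fuel G eq′ ⟩
          r N (proj₁ (from M.⊤ᶠ)) + rk M               ∎
      where
      open ≡-Reasoning
      G : Flat M
      G = M.adjoin F e
      fromG⋖fromF : from G N.⋖ from F
      fromG⋖fromF = from-⋖ (M.⋖-adjoin F e∉F)
      eq′ : fuel + r M (proj₁ G) ≡ rk M
      eq′ = trans (cong (fuel +_) (M.r-adjoin F e∉F)) (trans (+-suc fuel _) eq)

  modular : Modular M
  modular X Y X-flat Y-flat =
    ≤-antisym (+-constant-≤ (r N ∘ proj₁ ∘ from) (r M ∘ proj₁) rank-sum X∧Y X∨Y Xᶠ Yᶠ N-side) submodular
    where
    Xᶠ Yᶠ X∧Y X∨Y : Flat M
    Xᶠ = X , X-flat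
    Yᶠ = Y , Y-flat
    X∧Y = X ∩ Y , M.∩-flat X-flat Y-flat
    X∨Y = cl M (X ∪ Y) , M.cl-flat _
    A B : Subset m
    A = proj₁ (from Xᶠ)
    B = proj₁ (from Yᶠ)
    submodular : r M (X ∩ Y) + r M (cl M (X ∪ Y)) ≤ r M X + r M Y
    submodular = subst (_≤ r M X + r M Y)
      (trans (+-comm (r M (X ∪ Y)) _) (cong (r M (X ∩ Y) +_) (sym (M.r-cl (X ∪ Y))))) (r-submod M X Y)
    A∨B : Flat N
    A∨B = cl N (A ∪ B) , N.cl-flat (A ∪ B)
    from-∧ : from X∧Y ⊑ A∨B
    from-∧ = to⊑⇒from⊑ {X∧Y} {A∨B}
      (∩-glb (from⊑⇒to⊑ (N.⊆-cl (A ∪ B) ∘ ⊆-∪ˡ)) (from⊑⇒to⊑ (N.⊆-cl (A ∪ B) ∘ ⊆-∪ʳ)))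
    from-∨ : from X∨Y ⊑ (A ∩ B , N.∩-flat (proj₂ (from Xᶠ)) (proj₂ (from Yᶠ)))
    from-∨ = ∩-glb (from-antitone (M.⊆-cl _ ∘ ⊆-∪ˡ)) (from-antitone (M.⊆-cl _ ∘ ⊆-∪ʳ))
    N-side : r N (proj₁ (from X∧Y)) + r N (proj₁ (from X∨Y)) ≤ r N A + r N B
    N-side = begin
      r N (proj₁ (from X∧Y)) + r N (proj₁ (from X∨Y)) ≤⟨ +-mono-≤ (r-mono N from-∧) (r-mono N from-∨) ⟩
      r N (cl N (A ∪ B)) + r N (A ∩ B)               ≡⟨ cong (_+ r N (A ∩ B)) (N.r-cl _) ⟩
      r N (A ∪ B) + r N (A ∩ B)                      ≤⟨ r-submod N A B ⟩
      r N A + r N B                                  ∎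
      where open ≤-Reasoning

  adjoint : rk N ≡ rk M → Adjoint M N
  adjoint rk-eq = record
    { φ = from
    ; rank-eq = rk-eq
    ; injective = λ _ _ eq → ⊆-antisym (from-reflects (⊆-reflexive (sym eq))) (from-reflects (⊆-reflexive eq))
    ; antitone = λ _ _ → from-antitone
    ; coatom→atom = coatom→atom
    ; atom-onto = λ A A-atom → to A , atom→coatom A A-atom , from-to A
    }
    where
    coatom→atom : ∀ H → IsCoatom M H → IsAtom N (from H)
    coatom→atom H (H-not-top , covered) = (λ bot → H-not-top (λ G → from-reflects (bot (from G)))) , above-bottom
      where
      above-bottom : ∀ G → G ⊑ from H → from H ⊑ G ⊎ IsBottom N G
      above-bottom G G⊑H with covered (to G) (⊑from⇒⊑to G⊑H)
      ... | inj₁ G⊑H′ = inj₁ (to⊑⇒from⊑ G⊑H′)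
      ... | inj₂ top = inj₂ (λ K → to-rev⁻ G K (top (to K)))
    atom→coatom : ∀ A → IsAtom N A → IsCoatom M (to A)
    atom→coatom A (A-not-bot , covers) = (λ top → A-not-bot (λ G → to-rev⁻ A G (top (to G)))) , below-top
      where
      below-top : ∀ G → to A ⊑ G → G ⊑ to A ⊎ IsTop M G
      below-top G A⊑G with covers (from G) (to⊑⇒from⊑ A⊑G)
      ... | inj₁ A⊑G′ = inj₁ (⊑from⇒⊑to A⊑G′)
      ... | inj₂ bot = inj₂ (λ K → from-reflects (bot (from K)))

module HyperplaneMatroid {k : ℕ} (M : Matroid k) (modular : Modular M) where
  open FlatTheory M

  hyperplaneOr⊤ : Subset k → Subset k
  hyperplaneOr⊤ X = if ⌊ isHyperplane? X ⌋ then X else ⊤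

  hyperplaneOr⊤-flat : ∀ X → IsFlat M (hyperplaneOr⊤ X)
  hyperplaneOr⊤-flat X with isHyperplane? X
  ... | yes (X-flat , _) = X-flat
  ... | no _ = proj₂ ⊤ᶠ

  hyperplaneOr⊤-corank : ∀ X → rk M ≤ suc (r M (hyperplaneOr⊤ X))
  hyperplaneOr⊤-corank X with isHyperplane? X
  ... | yes (_ , corank≡1) = ≤-reflexive (sym corank≡1)
  ... | no _ = n≤1+n (rk M)

  hyperplaneOr⊤-hyperplane : ∀ {X} → IsHyperplane X → hyperplaneOr⊤ X ≡ X
  hyperplaneOr⊤-hyperplane {X} X-hyp with isHyperplane? X
  ... | yes _ = refl
  ... | no ¬X-hyp = contradiction X-hyp ¬X-hyp

  m : ℕ
  m = length (subsets k)

  -- Every subset of the ground set gets an index, non-hyperplanes being replaced by ⊤ (loops of N);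
  -- index 0 only pads the ground set to the nonempty Fin (suc m).
  H : Fin (suc m) → Subset k
  H zero = ⊤
  H (suc i) = hyperplaneOr⊤ (lookup (subsets k) i)

  H-flat : ∀ i → IsFlat M (H i)
  H-flat zero = proj₂ ⊤ᶠ
  H-flat (suc i) = hyperplaneOr⊤-flat _

  H-corank : ∀ i → rk M ≤ suc (r M (H i))
  H-corank zero = ≤-trans (r≤rk ⊤) (n≤1+n _)
  H-corank (suc i) = hyperplaneOr⊤-corank _

  H-onto : ∀ {X} → IsHyperplane X → ∃ λ i → H i ≡ X
  H-onto {X} X-hyp = suc (Any.index (∈-subsets X)) ,
    trans (cong hyperplaneOr⊤ (sym (lookup-index (∈-subsets X)))) (hyperplaneOr⊤-hyperplane X-hyp)

  meet : Subset (suc m) → Subset k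
  meet T = ⋂[ T ] H

  meet-flat : ∀ T → IsFlat M (meet T)
  meet-flat T = ⋂-flat T H-flat

  above : Subset k → Subset (suc m)
  above F = toSubset (λ i → F ⊆? H i)

  ∈above⁺ : ∀ {F i} → F ⊆ H i → i ∈ above F
  ∈above⁺ {F} = ∈-toSubset⁺ (λ i → F ⊆? H i)

  ∈above⁻ : ∀ {F i} → i ∈ above F → F ⊆ H i
  ∈above⁻ {F} = ∈-toSubset⁻ (λ i → F ⊆? H i)

  above-antitone : ∀ {F G} → F ⊆ G → above G ⊆ above F
  above-antitone F⊆G i∈aboveG = ∈above⁺ (∈above⁻ i∈aboveG ∘ F⊆G)

  meet-above : ∀ {F} → IsFlat M F → meet (above F) ≡ F
  meet-above {F} F-flat = ⊆-antisym meet⊆F (λ e∈F → ∈⋂⁺ (above F) H (λ i∈above → ∈above⁻ i∈above e∈F))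
    where
    meet⊆F : meet (above F) ⊆ F
    meet⊆F {e} e∈meet with e ∈? F
    ... | yes e∈F = e∈F
    ... | no e∉F with hyperplane-separating (F , F-flat) e∉F
    ...   | X , X-hyp , F⊆X , e∉X with H-onto X-hyp
    ...     | i , Hi≡X = contradiction
              (subst (e ∈_) Hi≡X (∈⋂⁻ (above F) H e∈meet (∈above⁺ {i = i} (subst (F ⊆_) (sym Hi≡X) F⊆X)))) e∉X

  meet-∪⁅⁆ : ∀ T {i} → meet T ⊆ H i → meet (T ∪ ⁅ i ⁆) ≡ meet T
  meet-∪⁅⁆ T {i} meetT⊆Hi = ⊆-antisym (⋂-antitone {T = T} {T′ = T ∪ ⁅ i ⁆} H ⊆-∪ˡ) (λ {e} e∈meetT →
    ∈⋂⁺ (T ∪ ⁅ i ⁆) H (λ {j} j∈T∪i →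
      [ ∈⋂⁻ T H e∈meetT , (λ j∈⁅i⁆ → subst (λ j → e ∈ H j) (sym (x∈⁅y⁆⇒x≡y i j∈⁅i⁆)) (meetT⊆Hi e∈meetT)) ]
        (x∈p∪q⁻ T ⁅ i ⁆ j∈T∪i)))

  rN : Subset (suc m) → ℕ
  rN T = rk M ∸ r M (meet T)

  N : Matroid (suc m)
  N = record
    { r = rN
    ; r-card = λ T → m≤n+o⇒m∸n≤o (rk M) (r M (meet T)) (⋂-corank-≤ modular T H-flat H-corank)
    ; r-mono = λ T⊆T′ → ∸-monoʳ-≤ (rk M) (r-mono M (⋂-antitone H T⊆T′))
    ; r-submod = submod
    }
    where
    submod : ∀ T T′ → rN (T ∪ T′) + rN (T ∩ T′) ≤ rN T + rN T′
    submod T T′ = begin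
      rN (T ∪ T′) + rN (T ∩ T′)                                ≤⟨ +-mono-≤ (∸-monoʳ-≤ (rk M) (r-mono M meet-∪))
                                                                            (∸-monoʳ-≤ (rk M) (r-mono M meet-∩)) ⟩
      (rk M ∸ r M (A ∩ B)) + (rk M ∸ r M (cl M (A ∪ B)))       ≡⟨ ∸-+-≡ (rk M) (r≤rk A) (r≤rk B) (r≤rk _) (r≤rk _)
                                                                            (modular A B (meet-flat T) (meet-flat T′)) ⟩
      rN T + rN T′                                             ∎
      where
      open ≤-Reasoning
      A B : Subset k
      A = meet T
      B = meet T′
      meet-∪ : A ∩ B ⊆ meet (T ∪ T′)
      meet-∪ e∈A∩B = ∈⋂⁺ (T ∪ T′) H (λ {i} i∈T∪T′ →
        [ ∈⋂⁻ T H (∩-⊆ˡ e∈A∩B) , ∈⋂⁻ T′ H (∩-⊆ʳ e∈A∩B) ] (x∈p∪q⁻ T T′ i∈T∪T′))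
      meet-∩ : cl M (A ∪ B) ⊆ meet (T ∩ T′)
      meet-∩ = cl-least (meet-flat (T ∩ T′))
        (∪-lub (⋂-antitone {T = T ∩ T′} {T′ = T} H ∩-⊆ˡ) (⋂-antitone {T = T ∩ T′} {T′ = T′} H ∩-⊆ʳ))

  rN-∪⁅⁆ : ∀ T {i} → rN (T ∪ ⁅ i ⁆) ≡ rN T → meet T ⊆ meet (T ∪ ⁅ i ⁆)
  rN-∪⁅⁆ T {i} eq = flat-rank-⊆ (meet-flat (T ∪ ⁅ i ⁆)) (⋂-antitone {T = T} {T′ = T ∪ ⁅ i ⁆} H ⊆-∪ˡ)
    (≤-reflexive (∸-cancelˡ-≡ (r≤rk _) (r≤rk _) (sym eq)))

  above-flat : ∀ {F} → IsFlat M F → IsFlat N (above F)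
  above-flat {F} F-flat i eq = ∈above⁺ (λ e∈F →
    ∈⋂⁻ (above F ∪ ⁅ i ⁆) H (rN-∪⁅⁆ (above F) {i} eq (subst (_ ∈_) (sym (meet-above F-flat)) e∈F)) (⊆-∪ʳ (x∈⁅x⁆ i)))

  above-meet : ∀ {T} → IsFlat N T → above (meet T) ≡ T
  above-meet {T} T-flat = ⊆-antisym
    (λ {i} i∈above → T-flat i (cong (λ X → rk M ∸ r M X) (meet-∪⁅⁆ T (∈above⁻ i∈above))))
    (λ i∈T → ∈above⁺ (λ e∈meet → ∈⋂⁻ T H e∈meet i∈T))

  antiIso : FlatsAntiIso N M
  antiIso = record
    { to = λ T → meet (proj₁ T) , meet-flat (proj₁ T)
    ; from = λ F → above (proj₁ F) , above-flat (proj₂ F)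
    ; from-to = λ T → above-meet (proj₂ T)
    ; to-from = λ F → meet-above (proj₂ F)
    ; to-rev = λ _ _ → ⋂-antitone H
    ; to-rev⁻ = λ T U meetU⊆meetT → subst₂ _⊆_ (above-meet (proj₂ T)) (above-meet (proj₂ U)) (above-antitone meetU⊆meetT)
    }

  rk-N : rk N ≡ rk M
  rk-N = cong (rk M ∸_) (n≤0⇒n≡0 (begin
    r M (meet ⊤)                    ≤⟨ r-mono M (⋂-antitone H (⊆⊤ {p = above (cl M ⊥)})) ⟩
    r M (meet (above (cl M ⊥)))     ≡⟨ cong (r M) (meet-above (cl-flat ⊥)) ⟩
    r M (cl M ⊥)                    ≡⟨ r-cl ⊥ ⟩
    r M ⊥                           ≡⟨ r-⊥ ⟩
    0                               ∎))
    where open ≤-Reasoning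

proposition4p1 : ∀ (n : ℕ) (M : Matroid (suc n)) → Simple M →
    (Modular M → Σ ℕ (λ m → Σ (Matroid (suc m)) (λ N → Adjoint M N × FlatsAntiIso N M)))
    × (Σ ℕ (λ m → Σ (Matroid (suc m)) (λ N → Adjoint M N × FlatsAntiIso N M)) → Modular M)
proposition4p1 n M _ = adjoint-of-modular , λ (_ , _ , _ , I) → AntiIso.modular I
  where
  adjoint-of-modular : Modular M → Σ ℕ (λ m → Σ (Matroid (suc m)) (λ N → Adjoint M N × FlatsAntiIso N M))
  adjoint-of-modular modular = m , N , AntiIso.adjoint antiIso rk-N , antiIso
    where open HyperplaneMatroid M modular
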